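{- Let $q$ be a prime power and $h$ a nonnegative integer. Let $M$ be a matroid and $X\subseteq E(M)$ such that $r_M(X)\le h$ and $\mathrm{si}(M\setminus X)\cong \mathrm{PG}(r(M)-1,q)$. Then $M/X$ has no restriction that is a $(q,h+1)$-stack.
   Context: $\mathrm{si}(N)$ is the simplification of $N$ and $\mathrm{PG}(k-1,q)$ is the rank-$k$ projective geometry over $\mathrm{GF}(q)$. For a prime power $q$ and nonnegative integers $h,t$, a matroid $S$ is a $(q,h,t)$-stack if there are pairwise disjoint subsets $F_1,\dots,F_h$ of $E(S)$ whose union is spanning in $S$, such that for each $i\in\{1,\dots,h\}$ the matroid $(S/(F_1\cup\dots\cup F_{i-1}))|F_i$ has rank at most $t$ and is not $\mathrm{GF}(q)$-representable. A $(q,h)$-stack is a matroid that is a $(q,h,t)$-stack for some nonnegative integer $t$. A restriction of a matroid $N$ is $N|Y$ for some $Y\subseteq E(N)$. -}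

module Defs where

open import Data.Nat using (ℕ; zero; suc; _≤_; _<_; _∸_; _^_)
open import Data.Nat.Primality using (Prime)
open import Data.Fin using (Fin; zero; suc; toℕ)
open import Data.Fin.Subset using (Subset; _∈_; _∉_; _⊆_; _∪_; _∩_; _─_; ∁; ⊥; ⊤; ⁅_⁆; ∣_∣)
open import Data.Product using (Σ; ∃; _×_; _,_)
open import Relation.Binary.PropositionalEquality using (_≡_; _≢_)
open import Relation.Nullary using (¬_)
open import Algebra.Structures using (IsCommutativeRing)

IsPrimePower : ℕ → Set
IsPrimePower q = Σ ℕ λ p → Σ ℕ λ k → Prime p × (1 ≤ k) × (q ≡ p ^ k)

-- A finite field with exactly q elements, carried by Fin q
-- (any GF(q) is isomorphic to such a structure).

record FiniteField (q : ℕ) : Set where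
  infixl 6 _+_
  infixl 7 _*_
  field
    _+_ _*_    : Fin q → Fin q → Fin q
    -_         : Fin q → Fin q
    0# 1#      : Fin q
    isCommutativeRing : IsCommutativeRing _≡_ _+_ _*_ -_ 0# 1#
    0≢1        : 0# ≢ 1#
    inverse    : ∀ x → x ≢ 0# → Σ (Fin q) λ y → x * y ≡ 1#

record Matroid (n : ℕ) : Set where
  field
    rank    : Subset n → ℕ
    bounded : ∀ X → rank X ≤ ∣ X ∣
    mono    : ∀ X Y → X ⊆ Y → rank X ≤ rank Y
    submod  : ∀ X Y → rank (X ∪ Y) Data.Nat.+ rank (X ∩ Y) ≤ rank X Data.Nat.+ rank Y

-- A minor of a matroid on Fin n: a ground set (subset of Fin n) together
-- with the rank function, meaningful on subsets of the ground set.
record Minor (n : ℕ) : Set where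
  constructor minor
  field
    rk     : Subset n → ℕ
    ground : Subset n

open Minor public

asMinor : ∀ {n} → Matroid n → Minor n
asMinor M = minor (Matroid.rank M) ⊤

restrict : ∀ {n} → Minor n → Subset n → Minor n
restrict N Y = minor (rk N) Y

delete : ∀ {n} → Minor n → Subset n → Minor n
delete N X = minor (rk N) (ground N ─ X)

contract : ∀ {n} → Minor n → Subset n → Minor n
contract N C = minor (λ Z → rk N (Z ∪ C) ∸ rk N C) (ground N ─ C)

Indep : ∀ {n} → Minor n → Subset n → Set
Indep N Z = rk N Z ≡ ∣ Z ∣

module _ {q : ℕ} (F : FiniteField q) where
  open FiniteField F

  sumF : ∀ {n} → (Fin n → Fin q) → Fin q
  sumF {zero}  f = 0#
  sumF {suc n} f = f zero + sumF (λ i → f (suc i))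

  LinIndep : ∀ {n k} → (Fin n → Fin k → Fin q) → Subset n → Set
  LinIndep {n} {k} v Z =
    (c : Fin n → Fin q) →
    (∀ e → e ∉ Z → c e ≡ 0#) →
    (∀ (j : Fin k) → sumF (λ e → c e * v e j) ≡ 0#) →
    ∀ e → e ∈ Z → c e ≡ 0#

  Representable : ∀ {n} → Minor n → Set
  Representable {n} N =
    Σ ℕ λ k → Σ (Fin n → Fin k → Fin q) λ v →
      ∀ Z → Z ⊆ ground N → ((Indep N Z → LinIndep v Z) × (LinIndep v Z → Indep N Z))

  -- canonical representatives of the points of PG(r-1,F): nonzero vectors
  -- whose first nonzero coordinate is 1
  Normalized : ∀ {r} → (Fin r → Fin q) → Set
  Normalized {r} w = Σ (Fin r) λ j → (w j ≡ 1#) × (∀ i → toℕ i < toℕ j → w i ≡ 0#)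

  IsoPG : ∀ {n} → Minor n → ℕ → Set
  IsoPG {n} N r =
    Σ (Fin n → Fin r → Fin q) λ φ →
      (∀ e → e ∈ ground N → Normalized (φ e)) ×
      (∀ e f → e ∈ ground N → f ∈ ground N → φ e ≡ φ f → e ≡ f) ×
      (∀ (w : Fin r → Fin q) → Normalized w → Σ (Fin n) λ e → (e ∈ ground N) × (φ e ≡ w)) ×
      (∀ Z → Z ⊆ ground N → ((Indep N Z → LinIndep φ Z) × (LinIndep φ Z → Indep N Z)))

  before : ∀ {n h} → (Fin h → Subset n) → Fin h → Subset n
  before Fs zero    = ⊥
  before Fs (suc i) = Fs zero ∪ before (λ j → Fs (suc j)) i

  bigUnion : ∀ {n h} → (Fin h → Subset n) → Subset n
  bigUnion {h = zero}  Fs = ⊥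
  bigUnion {h = suc h} Fs = Fs zero ∪ bigUnion (λ j → Fs (suc j))

  IsStackT : ∀ {n} → ℕ → ℕ → Minor n → Set
  IsStackT {n} h t S =
    Σ (Fin h → Subset n) λ Fs →
      (∀ i → Fs i ⊆ ground S) ×
      (∀ i j → i ≢ j → Fs i ∩ Fs j ≡ ⊥) ×
      (rk S (bigUnion Fs) ≡ rk S (ground S)) ×
      (∀ i → let Ni = restrict (contract S (before Fs i)) (Fs i) in
               (rk Ni (Fs i) ≤ t) × ¬ Representable Ni)

  IsStack : ∀ {n} → ℕ → Minor n → Set
  IsStack h S = Σ ℕ λ t → IsStackT h t S

-- Simplification: si(N) is represented (up to isomorphism) by N|R where R
-- contains no loops and exactly one element of each parallel class of
-- non-loops of N.

Parallel : ∀ {n} → Minor n → Fin n → Fin n → Set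
Parallel N e f = rk N (⁅ e ⁆ ∪ ⁅ f ⁆) ≡ 1

NonLoop : ∀ {n} → Minor n → Fin n → Set
NonLoop N e = rk N ⁅ e ⁆ ≡ 1

IsSimplificationSet : ∀ {n} → Minor n → Subset n → Set
IsSimplificationSet N R =
  (R ⊆ ground N) ×
  (∀ e → e ∈ R → NonLoop N e) ×
  (∀ e → e ∈ ground N → NonLoop N e →
     Σ _ (λ f → (f ∈ R) × Parallel N e f) ×
     (∀ f f′ → f ∈ R → f′ ∈ R → Parallel N e f → Parallel N e f′ → f ≡ f′))

SiIsoPG : ∀ {n q} → FiniteField q → Minor n → ℕ → Set
SiIsoPG F N r = Σ _ λ R → IsSimplificationSet N R × IsoPG F (restrict N R) r

-- The F-representability of si(M \ X) lifts to M \ X (a loop gets the zero vector, every other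
-- element the vector of its parallel representative) and then to every contraction (M \ X) / C
-- (an element is contracted by projecting away from its vector). If X and a set D were skew in
-- M / C, the rank functions of M / X / C and M / C would agree on subsets of D, so (M / X / C) | D
-- would be representable. Hence each layer F_i of a stack in M / X, taken over
-- C = F₁ ∪ … ∪ F_{i-1}, lowers r_{M / C}(X) by at least one, and h + 1 layers need r(X) ≥ h + 1.

module Submission where

open import Defs
open import Data.Nat using (ℕ; zero; suc; _≤_)
open import Data.Nat.Properties using (≤⇒≯)
open import Data.Fin using (Fin; zero; suc; _≟_)
import Data.Fin.Properties as Fin
open import Data.Fin.Subset
open import Data.Fin.Subset.Properties
open import Data.Fin.Subset.Induction using (⊂-wellFounded)
open import Data.Product using (Σ; _×_; _,_; proj₁; proj₂; map₂)
open import Data.Sum using (_⊎_; inj₁; inj₂; [_,_]′)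
open import Data.Vec using (_∷_; _[_]=_)
open _[_]=_
open import Data.Vec.Functional using (updateAt)
open import Data.Vec.Functional.Properties using (updateAt-updates; updateAt-minimal)
open import Function using (_∘_; id; const; _⇔_; mk⇔; Equivalence)
open import Function.Properties.Equivalence using (⇔-setoid)
open import Induction.WellFounded using (module All)
open import Algebra.Bundles using (CommutativeRing)
open import Relation.Nullary using (¬_; Dec; yes; no; contradiction)
open import Relation.Binary.PropositionalEquality
open import Level using (0ℓ)
import Relation.Binary.Reasoning.Setoid as SetoidReasoning

module ⇔-Reasoning = SetoidReasoning (⇔-setoid 0ℓ)

cong-≡⇔ : ∀ {A : Set} {a b c d : A} → a ≡ b → c ≡ d → (a ≡ c) ⇔ (b ≡ d)
cong-≡⇔ refl refl = mk⇔ id id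

¬×¬⇒⇔ : ∀ {A B : Set} → ¬ A → ¬ B → A ⇔ B
¬×¬⇒⇔ ¬a ¬b = mk⇔ (λ a → contradiction a ¬a) (λ b → contradiction b ¬b)

module _ where

  open import Data.Nat using (_+_; _∸_; _<_; s≤s)
  open import Data.Nat.Properties
    using (suc-injective; ∸-+-assoc; m+[n∸m]≡n; [m+n]∸[m+o]≡n∸o; +-comm)

  n<m⇒m∸n≡1+[m∸1+n] : ∀ {m n} → n < m → m ∸ n ≡ suc (m ∸ suc n)
  n<m⇒m∸n≡1+[m∸1+n] {suc m} {zero}  _         = refl
  n<m⇒m∸n≡1+[m∸1+n] {suc m} {suc n} (s≤s n<m) = n<m⇒m∸n≡1+[m∸1+n] n<m

  m∸1+n≡o⇔m∸n≡1+o : ∀ {m n o} → n < m → (m ∸ suc n ≡ o) ⇔ (m ∸ n ≡ suc o)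
  m∸1+n≡o⇔m∸n≡1+o n<m = mk⇔ (λ eq → trans (n<m⇒m∸n≡1+[m∸1+n] n<m) (cong suc eq))
                            (λ eq → suc-injective (trans (sym (n<m⇒m∸n≡1+[m∸1+n] n<m)) eq))

  [m∸n]∸[o∸n]≡m∸o : ∀ m {n o} → n ≤ o → (m ∸ n) ∸ (o ∸ n) ≡ m ∸ o
  [m∸n]∸[o∸n]≡m∸o m {n} {o} n≤o =
    trans (∸-+-assoc m n (o ∸ n)) (cong (m ∸_) (m+[n∸m]≡n n≤o))

  m+n≡o+p⇒m∸p≡o∸n : ∀ m n o p → m + n ≡ o + p → m ∸ p ≡ o ∸ n
  m+n≡o+p⇒m∸p≡o∸n m n o p eq = begin
    m ∸ p               ≡⟨ [m+n]∸[m+o]≡n∸o n m p ⟨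
    (n + m) ∸ (n + p)   ≡⟨ cong₂ _∸_ (trans (+-comm n m) (trans eq (+-comm o p)))
                                     (+-comm n p) ⟩
    (p + o) ∸ (p + n)   ≡⟨ [m+n]∸[m+o]≡n∸o p o n ⟩
    o ∸ n               ∎
    where open ≡-Reasoning

module _ where

  private variable
    n : ℕ
    p q r s : Subset n
    x y : Fin n

  ∪-lub : p ⊆ r → q ⊆ r → p ∪ q ⊆ r
  ∪-lub {p = p} {q = q} p⊆r q⊆r x∈p∪q = [ p⊆r , q⊆r ]′ (x∈p∪q⁻ p q x∈p∪q)

  ∩-glb : r ⊆ p → r ⊆ q → r ⊆ p ∩ q
  ∩-glb r⊆p r⊆q x∈r = x∈p∩q⁺ (r⊆p x∈r , r⊆q x∈r)

  ∪-mono : p ⊆ r → q ⊆ s → p ∪ q ⊆ r ∪ s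
  ∪-mono {r = r} {s = s} p⊆r q⊆s = ∪-lub (p⊆p∪q s ∘ p⊆r) (q⊆p∪q r s ∘ q⊆s)

  x∉p∧x≢y⇒x∉p∪⁅y⁆ : x ∉ p → x ≢ y → x ∉ p ∪ ⁅ y ⁆
  x∉p∧x≢y⇒x∉p∪⁅y⁆ {x = x} {p = p} {y = y} x∉p x≢y x∈p∪⁅y⁆ =
    [ x∉p , x≢y ∘ x∈⁅y⁆⇒x≡y y ]′ (x∈p∪q⁻ p ⁅ y ⁆ x∈p∪⁅y⁆)

  p⊆q∪⁅x⁆∧x∉p⇒p⊆q : p ⊆ q ∪ ⁅ x ⁆ → x ∉ p → p ⊆ q
  p⊆q∪⁅x⁆∧x∉p⇒p⊆q {q = q} {x = x} p⊆q∪x x∉p {y} y∈p =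
    [ id , (λ y∈⁅x⁆ → contradiction (subst (_∈ _) (x∈⁅y⁆⇒x≡y x y∈⁅x⁆) y∈p) x∉p) ]′
      (x∈p∪q⁻ q ⁅ x ⁆ (p⊆q∪x y∈p))

  x∈p─q⇒x∉q : ∀ (p q : Subset n) → x ∈ p ─ q → x ∉ q
  x∈p─q⇒x∉q (_ ∷ p) (outside ∷ q) here        ()
  x∈p─q⇒x∉q (_ ∷ p) (_ ∷ q)       (there x∈)  (there x∈q) = x∈p─q⇒x∉q p q x∈ x∈q

  p∪q─q⊆p : ∀ (p q : Subset n) → (p ∪ q) ─ q ⊆ p
  p∪q─q⊆p p q x∈p∪q─q =
    [ id , (λ x∈q → contradiction x∈q (x∈p─q⇒x∉q (p ∪ q) q x∈p∪q─q)) ]′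
      (x∈p∪q⁻ p q (p─q⊆p (p ∪ q) q x∈p∪q─q))

  p─q∪r⊆p─q : ∀ (p q r : Subset n) → p ─ (q ∪ r) ⊆ p ─ q
  p─q∪r⊆p─q p q r = p─q⊆p (p ─ q) r ∘ ⊆-reflexive (sym (p─q─r≡p─q∪r p q r))

  x∉p-x : ∀ (p : Subset n) x → x ∉ p - x
  x∉p-x p x x∈p-x = x∈p─q⇒x∉q p ⁅ x ⁆ x∈p-x (x∈⁅x⁆ x)

  p⊆p-x∪⁅x⁆ : ∀ (p : Subset n) x → p ⊆ (p - x) ∪ ⁅ x ⁆
  p⊆p-x∪⁅x⁆ p x {y} y∈p with y ≟ x
  ... | yes refl = q⊆p∪q (p - x) ⁅ x ⁆ (x∈⁅x⁆ x)
  ... | no  y≢x  = p⊆p∪q ⁅ x ⁆ (x∈p∧x≢y⇒x∈p-y y∈p y≢x)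

  ⁅x⁆⊆p : x ∈ p → ⁅ x ⁆ ⊆ p
  ⁅x⁆⊆p {x = x} {p = p} x∈p y∈⁅x⁆ = subst (_∈ p) (sym (x∈⁅y⁆⇒x≡y x y∈⁅x⁆)) x∈p

  p-x∪⁅x⁆≡p : x ∈ p → (p - x) ∪ ⁅ x ⁆ ≡ p
  p-x∪⁅x⁆≡p {x = x} {p = p} x∈p =
    ⊆-antisym (∪-lub (p─q⊆p p ⁅ x ⁆) (⁅x⁆⊆p x∈p)) (p⊆p-x∪⁅x⁆ p x)

  ∣p∪⁅x⁆∣≡1+∣p∣ : x ∉ p → ∣ p ∪ ⁅ x ⁆ ∣ ≡ suc ∣ p ∣
  ∣p∪⁅x⁆∣≡1+∣p∣ {x = zero}  {p = inside  ∷ p} x∉p = contradiction here x∉p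
  ∣p∪⁅x⁆∣≡1+∣p∣ {x = zero}  {p = outside ∷ p} x∉p = cong (suc ∘ ∣_∣) (∪-identityʳ p)
  ∣p∪⁅x⁆∣≡1+∣p∣ {x = suc x} {p = inside  ∷ p} x∉p = cong suc (∣p∪⁅x⁆∣≡1+∣p∣ (x∉p ∘ there))
  ∣p∪⁅x⁆∣≡1+∣p∣ {x = suc x} {p = outside ∷ p} x∉p = ∣p∪⁅x⁆∣≡1+∣p∣ (x∉p ∘ there)

  ∣p∣≡1+∣p-x∣ : x ∈ p → ∣ p ∣ ≡ suc ∣ p - x ∣
  ∣p∣≡1+∣p-x∣ {x = x} {p = p} x∈p =
    trans (cong ∣_∣ (sym (p-x∪⁅x⁆≡p x∈p))) (∣p∪⁅x⁆∣≡1+∣p∣ (x∉p-x p x))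

  subset-induction : ∀ {ℓ} (P : Subset n → Set ℓ) → P ⊥ →
                     (∀ p x → x ∉ p → P p → P (p ∪ ⁅ x ⁆)) → ∀ p → P p
  subset-induction {ℓ = ℓ} P P⊥ P∪⁅⁆ = All.wfRec ⊂-wellFounded ℓ P step
    where
    step : ∀ p → (∀ {p′} → p′ ⊂ p → P p′) → P p
    step p rec with nonempty? p
    ... | no  p-empty       = subst P (sym (Empty-unique p-empty)) P⊥
    ... | yes (x , x∈p) =
      subst P (p-x∪⁅x⁆≡p x∈p) (P∪⁅⁆ (p - x) x (x∉p-x p x) (rec (x∈p⇒p-x⊂p x∈p)))

module LinearAlgebra {q : ℕ} (F : FiniteField q) where

  open FiniteField F

  commutativeRing : CommutativeRing _ _
  commutativeRing = record { isCommutativeRing = isCommutativeRing }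

  open CommutativeRing commutativeRing
    using ( +-identityˡ; +-identityʳ; +-comm; *-identityˡ; *-identityʳ; *-assoc
          ; zeroˡ; zeroʳ; distribˡ; distribʳ; -‿inverseˡ; -‿inverseʳ
          ; +-commutativeSemigroup; semiring; ring)
  open import Algebra.Properties.Semiring.Sum semiring
    using (sum; sum-cong-≗; sum-replicate-zero; ∑-distrib-+; *-distribʳ-sum)
  open import Algebra.Properties.Ring ring using (-‿distribˡ-*; -‿distribʳ-*)
  open import Algebra.Properties.CommutativeSemigroup +-commutativeSemigroup using (x∙yz≈y∙xz)
  open ≡-Reasoning

  private variable
    m n k : ℕ

  sumF≡sum : (f : Fin m → Fin q) → sumF F f ≡ sum f
  sumF≡sum {zero}  f = refl
  sumF≡sum {suc m} f = cong (f zero +_) (sumF≡sum (f ∘ suc))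

  sumF-cong : {f g : Fin m → Fin q} → f ≗ g → sumF F f ≡ sumF F g
  sumF-cong {f = f} {g} f≗g = begin
    sumF F f ≡⟨ sumF≡sum f ⟩
    sum f    ≡⟨ sum-cong-≗ f≗g ⟩
    sum g    ≡⟨ sumF≡sum g ⟨
    sumF F g ∎

  sumF-zero : {f : Fin m → Fin q} → (∀ x → f x ≡ 0#) → sumF F f ≡ 0#
  sumF-zero {m} {f} f≗0 = begin
    sumF F f              ≡⟨ sumF-cong {g = const 0#} f≗0 ⟩
    sumF F {m} (const 0#) ≡⟨ sumF≡sum {m} (const 0#) ⟩
    sum {m} (const 0#)    ≡⟨ sum-replicate-zero m ⟩
    0#                    ∎

  sumF-split : (f : Fin m → Fin q) (e : Fin m) → sumF F f ≡ f e + sumF F (updateAt f e (const 0#))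
  sumF-split {suc m} f zero    = cong (f zero +_) (sym (+-identityˡ _))
  sumF-split {suc m} f (suc e) = begin
    f zero + sumF F (f ∘ suc)
      ≡⟨ cong (f zero +_) (sumF-split (f ∘ suc) e) ⟩
    f zero + (f (suc e) + sumF F (updateAt (f ∘ suc) e (const 0#)))
      ≡⟨ x∙yz≈y∙xz (f zero) (f (suc e)) _ ⟩
    f (suc e) + (f zero + sumF F (updateAt (f ∘ suc) e (const 0#))) ∎

  sumF-split-at : {f g : Fin m → Fin q} (e : Fin m) → (∀ x → x ≢ e → f x ≡ g x) → g e ≡ 0# →
                  sumF F f ≡ f e + sumF F g
  sumF-split-at {f = f} {g} e f≗g g₀ = trans (sumF-split f e) (cong (f e +_) (sumF-cong agree))
    where
    agree : updateAt f e (const 0#) ≗ g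
    agree x with x ≟ e
    ... | yes refl = trans (updateAt-updates x f) (sym g₀)
    ... | no  x≢e  = trans (updateAt-minimal x e f x≢e) (f≗g x x≢e)

  sumF-single : {f : Fin m → Fin q} (e : Fin m) → (∀ x → x ≢ e → f x ≡ 0#) → sumF F f ≡ f e
  sumF-single {m} {f} e f₀ = begin
    sumF F f                  ≡⟨ sumF-split-at {g = const 0#} e f₀ refl ⟩
    f e + sumF F {m} (const 0#) ≡⟨ cong (f e +_) (sumF-zero {m} (λ _ → refl)) ⟩
    f e + 0#                  ≡⟨ +-identityʳ (f e) ⟩
    f e                       ∎

  sumF-distrib-+ : (f g : Fin m → Fin q) → sumF F (λ x → f x + g x) ≡ sumF F f + sumF F g
  sumF-distrib-+ f g = begin
    sumF F (λ x → f x + g x) ≡⟨ sumF≡sum (λ x → f x + g x) ⟩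
    sum (λ x → f x + g x)    ≡⟨ ∑-distrib-+ f g ⟩
    sum f + sum g            ≡⟨ cong₂ _+_ (sumF≡sum f) (sumF≡sum g) ⟨
    sumF F f + sumF F g      ∎

  sumF-*ʳ : (f : Fin m → Fin q) (a : Fin q) → sumF F (λ x → f x * a) ≡ sumF F f * a
  sumF-*ʳ f a = begin
    sumF F (λ x → f x * a) ≡⟨ sumF≡sum (λ x → f x * a) ⟩
    sum (λ x → f x * a)    ≡⟨ *-distribʳ-sum a f ⟨
    sum f * a              ≡⟨ cong (_* a) (sumF≡sum f) ⟨
    sumF F f * a           ∎

  x≡0⇒x*y≡0 : ∀ {x y} → x ≡ 0# → x * y ≡ 0#
  x≡0⇒x*y≡0 {y = y} refl = zeroˡ y

  lincomb : (Fin n → Fin k → Fin q) → (Fin n → Fin q) → Fin k → Fin q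
  lincomb v c t = sumF F (λ x → c x * v x t)

  lincomb-single : ∀ (v : Fin n → Fin k → Fin q) {c} e → (∀ x → x ≢ e → c x ≡ 0#) →
                   ∀ t → lincomb v c t ≡ c e * v e t
  lincomb-single v {c} e c₀ t = sumF-single e (λ x x≢e → x≡0⇒x*y≡0 (c₀ x x≢e))

  1≢0 : 1# ≢ 0#
  1≢0 = 0≢1 ∘ sym

  basis : Fin n → Fin n → Fin q
  basis e = updateAt (const 0#) e (const 1#)

  basis-other : ∀ (e : Fin n) {x} → x ≢ e → basis e x ≡ 0#
  basis-other e {x} x≢e = updateAt-minimal x e (const 0#) x≢e

  private variable
    v w : Fin n → Fin k → Fin q
    Z Z′ : Subset n
    e f : Fin n

  LinIndep-cong : (∀ x → x ∈ Z → ∀ t → v x t ≡ w x t) → LinIndep F v Z → LinIndep F w Z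
  LinIndep-cong {Z = Z} {v = v} {w = w} v≗w v-indep c c-supp c-rel =
    v-indep c c-supp (λ t → trans (sumF-cong (same-terms t)) (c-rel t))
    where
    same-terms : ∀ t x → c x * v x t ≡ c x * w x t
    same-terms t x with x ∈? Z
    ... | yes x∈Z = cong (c x *_) (v≗w x x∈Z t)
    ... | no  x∉Z = trans (x≡0⇒x*y≡0 (c-supp x x∉Z)) (sym (x≡0⇒x*y≡0 (c-supp x x∉Z)))

  LinIndep-mono : Z ⊆ Z′ → LinIndep F v Z′ → LinIndep F v Z
  LinIndep-mono Z⊆Z′ v-indep c c-supp c-rel x x∈Z =
    v-indep c (λ y y∉Z′ → c-supp y (y∉Z′ ∘ Z⊆Z′)) c-rel x (Z⊆Z′ x∈Z)

  ¬LinIndep-zero : e ∈ Z → (∀ t → v e t ≡ 0#) → ¬ LinIndep F v Z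
  ¬LinIndep-zero {e = e} {Z = Z} {v = v} e∈Z vₑ≡0 v-indep =
    1≢0 (trans (sym (updateAt-updates e (const 0#))) (v-indep (basis e) supp rel e e∈Z))
    where
    supp : ∀ x → x ∉ Z → basis e x ≡ 0#
    supp x x∉Z = basis-other e (λ { refl → x∉Z e∈Z })
    rel : ∀ t → lincomb v (basis e) t ≡ 0#
    rel t = begin
      lincomb v (basis e) t ≡⟨ lincomb-single v e (λ _ → basis-other e) t ⟩
      basis e e * v e t     ≡⟨ cong₂ _*_ (updateAt-updates e (const 0#)) (vₑ≡0 t) ⟩
      1# * 0#              ≡⟨ zeroʳ 1# ⟩
      0#                   ∎

  ¬LinIndep-repeat : e ∈ Z → f ∈ Z → e ≢ f → (∀ t → v e t ≡ v f t) → ¬ LinIndep F v Z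
  ¬LinIndep-repeat {e = e} {Z = Z} {f = f} {v = v} e∈Z f∈Z e≢f vₑ≡v_f v-indep =
    1≢0 (trans (sym cₑ≡1) (v-indep c supp rel e e∈Z))
    where
    c : _ → Fin q
    c = updateAt (basis e) f (const (- 1#))
    cₑ≡1 : c e ≡ 1#
    cₑ≡1 = trans (updateAt-minimal e f (basis e) e≢f) (updateAt-updates e (const 0#))
    supp : ∀ x → x ∉ Z → c x ≡ 0#
    supp x x∉Z = trans (updateAt-minimal x f (basis e) (λ { refl → x∉Z f∈Z }))
                       (basis-other e (λ { refl → x∉Z e∈Z }))
    rel : ∀ t → lincomb v c t ≡ 0#
    rel t = begin
      lincomb v c t
        ≡⟨ sumF-split-at f (λ x x≢f → cong (_* v x t) (updateAt-minimal x f (basis e) x≢f))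
                           (x≡0⇒x*y≡0 (basis-other e (e≢f ∘ sym))) ⟩
      c f * v f t + lincomb v (basis e) t
        ≡⟨ cong₂ _+_ (cong (_* v f t) (updateAt-updates f (basis e)))
                     (lincomb-single v e (λ _ → basis-other e) t) ⟩
      - 1# * v f t + basis e e * v e t
        ≡⟨ cong₂ (λ a b → - 1# * v f t + a * b) (updateAt-updates e (const 0#)) (vₑ≡v_f t) ⟩
      - 1# * v f t + 1# * v f t
        ≡⟨ distribʳ (v f t) (- 1#) 1# ⟨
      (- 1# + 1#) * v f t
        ≡⟨ cong (_* v f t) (-‿inverseˡ 1#) ⟩
      0# * v f t
        ≡⟨ zeroˡ _ ⟩
      0# ∎

  LinIndep-exchange : (∀ t → v e t ≡ v f t) → f ∉ Z →
                      LinIndep F v ((Z - e) ∪ ⁅ f ⁆) → LinIndep F v Z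
  LinIndep-exchange {v = v} {e = e} {f = f} {Z = Z} vₑ≡v_f f∉Z v-indep c c-supp c-rel = c≡0
    where
    c₀ c′ : _ → Fin q
    c₀ = updateAt c e (const 0#)
    c′ = updateAt c₀ f (const (c e))
    c₀≡c : ∀ x → x ≢ e → c₀ x ≡ c x
    c₀≡c x x≢e = updateAt-minimal x e c x≢e
    c₀-supp : ∀ x → x ∉ Z - e → c₀ x ≡ 0#
    c₀-supp x x∉Z-e with x ≟ e
    ... | yes refl = updateAt-updates x c
    ... | no  x≢e  = trans (c₀≡c x x≢e) (c-supp x (x∉Z-e ∘ λ x∈Z → x∈p∧x≢y⇒x∈p-y x∈Z x≢e))
    same-lincomb : ∀ t → lincomb v c′ t ≡ lincomb v c t
    same-lincomb t = begin
      lincomb v c′ t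
        ≡⟨ sumF-split-at f (λ x x≢f → cong (_* v x t) (updateAt-minimal x f c₀ x≢f))
                           (x≡0⇒x*y≡0 (c₀-supp f (f∉Z ∘ p─q⊆p Z ⁅ e ⁆))) ⟩
      c′ f * v f t + lincomb v c₀ t
        ≡⟨ cong₂ (λ a b → a * b + lincomb v c₀ t) (updateAt-updates f c₀) (sym (vₑ≡v_f t)) ⟩
      c e * v e t + lincomb v c₀ t
        ≡⟨ sumF-split-at e (λ x x≢e → cong (_* v x t) (sym (c₀≡c x x≢e)))
                           (x≡0⇒x*y≡0 (updateAt-updates e c)) ⟨
      lincomb v c t ∎
    c′-supp : ∀ x → x ∉ (Z - e) ∪ ⁅ f ⁆ → c′ x ≡ 0#
    c′-supp x x∉Z′ = trans (updateAt-minimal x f c₀ x≢f) (c₀-supp x (x∉Z′ ∘ p⊆p∪q ⁅ f ⁆))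
      where
      x≢f : x ≢ f
      x≢f refl = x∉Z′ (q⊆p∪q (Z - e) ⁅ f ⁆ (x∈⁅x⁆ x))
    c′≡0 : ∀ x → x ∈ (Z - e) ∪ ⁅ f ⁆ → c′ x ≡ 0#
    c′≡0 = v-indep c′ c′-supp (λ t → trans (same-lincomb t) (c-rel t))
    c≡0 : ∀ x → x ∈ Z → c x ≡ 0#
    c≡0 x x∈Z with x ≟ e
    ... | yes refl = trans (sym (updateAt-updates f c₀)) (c′≡0 f (q⊆p∪q (Z - e) ⁅ f ⁆ (x∈⁅x⁆ f)))
    ... | no  x≢e  = begin
      c x  ≡⟨ c₀≡c x x≢e ⟨
      c₀ x ≡⟨ updateAt-minimal x f c₀ (λ { refl → f∉Z x∈Z }) ⟨
      c′ x ≡⟨ c′≡0 x (p⊆p∪q ⁅ f ⁆ (x∈p∧x≢y⇒x∈p-y x∈Z x≢e)) ⟩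
      0#   ∎

  -- Projection along w e onto the hyperplane of vectors with vanishing j-th coordinate;
  -- ι is the inverse of w e j.
  module Projection (w : Fin n → Fin k → Fin q) (e : Fin n) (j : Fin k) (ι : Fin q)
                    (wₑⱼι≡1 : w e j * ι ≡ 1#) where

    μ : Fin k → Fin q
    μ t = - (ι * w e t)

    project : Fin n → Fin k → Fin q
    project x t = w x t + w x j * μ t

    project-e≡0 : ∀ t → project e t ≡ 0#
    project-e≡0 t = begin
      w e t + w e j * - (ι * w e t)     ≡⟨ cong (w e t +_) (-‿distribʳ-* (w e j) _) ⟨
      w e t + - (w e j * (ι * w e t))   ≡⟨ cong (λ a → w e t + - a) (*-assoc _ _ _) ⟨
      w e t + - ((w e j * ι) * w e t)   ≡⟨ cong (λ a → w e t + - (a * w e t)) wₑⱼι≡1 ⟩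
      w e t + - (1# * w e t)            ≡⟨ cong (λ a → w e t + - a) (*-identityˡ (w e t)) ⟩
      w e t + - w e t                   ≡⟨ -‿inverseʳ (w e t) ⟩
      0#                                ∎

    lincomb-project : ∀ c t → lincomb project c t ≡ lincomb w c t + lincomb w c j * μ t
    lincomb-project c t = begin
      lincomb project c t
        ≡⟨ sumF-cong (λ x → trans (distribˡ (c x) _ _) (cong (c x * w x t +_) (sym (*-assoc _ _ _))))
        ⟩
      sumF F (λ x → c x * w x t + (c x * w x j) * μ t)
        ≡⟨ sumF-distrib-+ (λ x → c x * w x t) (λ x → (c x * w x j) * μ t) ⟩
      lincomb w c t + sumF F (λ x → (c x * w x j) * μ t)
        ≡⟨ cong (lincomb w c t +_) (sumF-*ʳ (λ x → c x * w x j) (μ t)) ⟩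
      lincomb w c t + lincomb w c j * μ t ∎

    LinIndep-project⁺ : e ∉ Z → LinIndep F w (Z ∪ ⁅ e ⁆) → LinIndep F project Z
    LinIndep-project⁺ {Z = Z} e∉Z w-indep c c-supp c-rel = c≡0
      where
      S = lincomb w c j
      c′ : Fin n → Fin q
      c′ = updateAt c e (const (- (S * ι)))
      c′≡c : ∀ x → x ≢ e → c′ x ≡ c x
      c′≡c x x≢e = updateAt-minimal x e c x≢e
      c′-rel : ∀ t → lincomb w c′ t ≡ 0#
      c′-rel t = begin
        lincomb w c′ t
          ≡⟨ sumF-split-at e (λ x x≢e → cong (_* w x t) (c′≡c x x≢e))
                             (x≡0⇒x*y≡0 (c-supp e e∉Z)) ⟩
        c′ e * w e t + lincomb w c t
          ≡⟨ cong (λ a → a * w e t + lincomb w c t) (updateAt-updates e c) ⟩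
        - (S * ι) * w e t + lincomb w c t
          ≡⟨ +-comm _ _ ⟩
        lincomb w c t + - (S * ι) * w e t
          ≡⟨ cong (lincomb w c t +_) (-‿distribˡ-* (S * ι) (w e t)) ⟨
        lincomb w c t + - ((S * ι) * w e t)
          ≡⟨ cong (λ a → lincomb w c t + - a) (*-assoc S ι (w e t)) ⟩
        lincomb w c t + - (S * (ι * w e t))
          ≡⟨ cong (lincomb w c t +_) (-‿distribʳ-* S (ι * w e t)) ⟩
        lincomb w c t + S * μ t
          ≡⟨ lincomb-project c t ⟨
        lincomb project c t
          ≡⟨ c-rel t ⟩
        0# ∎
      c′-supp : ∀ x → x ∉ Z ∪ ⁅ e ⁆ → c′ x ≡ 0#
      c′-supp x x∉Z∪e = trans (c′≡c x x≢e) (c-supp x (x∉Z∪e ∘ p⊆p∪q ⁅ e ⁆))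
        where
        x≢e : x ≢ e
        x≢e refl = x∉Z∪e (q⊆p∪q Z ⁅ e ⁆ (x∈⁅x⁆ x))
      c≡0 : ∀ x → x ∈ Z → c x ≡ 0#
      c≡0 x x∈Z = trans (sym (c′≡c x (λ { refl → e∉Z x∈Z })))
                        (w-indep c′ c′-supp c′-rel x (p⊆p∪q ⁅ e ⁆ x∈Z))

    LinIndep-project⁻ : LinIndep F project Z → LinIndep F w (Z ∪ ⁅ e ⁆)
    LinIndep-project⁻ {Z = Z} p-indep c′ c′-supp c′-rel = c′≡0
      where
      c : Fin n → Fin q
      c = updateAt c′ e (const 0#)
      c≡c′ : ∀ x → x ≢ e → c x ≡ c′ x
      c≡c′ x x≢e = updateAt-minimal x e c′ x≢e
      c-supp : ∀ x → x ∉ Z → c x ≡ 0#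
      c-supp x x∉Z with x ≟ e
      ... | yes refl = updateAt-updates x c′
      ... | no  x≢e  = trans (c≡c′ x x≢e) (c′-supp x (x∉p∧x≢y⇒x∉p∪⁅y⁆ x∉Z x≢e))
      c-rel : ∀ t → lincomb project c t ≡ 0#
      c-rel t = begin
        lincomb project c t
          ≡⟨ +-identityˡ _ ⟨
        0# + lincomb project c t
          ≡⟨ cong (_+ lincomb project c t) (trans (cong (c′ e *_) (project-e≡0 t)) (zeroʳ _)) ⟨
        c′ e * project e t + lincomb project c t
          ≡⟨ sumF-split-at e (λ x x≢e → cong (_* project x t) (sym (c≡c′ x x≢e)))
                             (x≡0⇒x*y≡0 (updateAt-updates e c′)) ⟨
        lincomb project c′ t
          ≡⟨ lincomb-project c′ t ⟩
        lincomb w c′ t + lincomb w c′ j * μ t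
          ≡⟨ cong₂ (λ a b → a + b * μ t) (c′-rel t) (c′-rel j) ⟩
        0# + 0# * μ t
          ≡⟨ trans (+-identityˡ _) (zeroˡ _) ⟩
        0# ∎
      c′≡0-off-e : ∀ x → x ≢ e → c′ x ≡ 0#
      c′≡0-off-e x x≢e with x ∈? Z
      ... | yes x∈Z = trans (sym (c≡c′ x x≢e)) (p-indep c c-supp c-rel x x∈Z)
      ... | no  x∉Z = c′-supp x (x∉p∧x≢y⇒x∉p∪⁅y⁆ x∉Z x≢e)
      c′ₑ≡0 : c′ e ≡ 0#
      c′ₑ≡0 = begin
        c′ e                   ≡⟨ *-identityʳ _ ⟨
        c′ e * 1#              ≡⟨ cong (c′ e *_) wₑⱼι≡1 ⟨
        c′ e * (w e j * ι)     ≡⟨ *-assoc _ _ _ ⟨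
        (c′ e * w e j) * ι     ≡⟨ cong (_* ι) (trans (sym (lincomb-single w e c′≡0-off-e j))
                                                         (c′-rel j)) ⟩
        0# * ι                 ≡⟨ zeroˡ ι ⟩
        0#                     ∎
      c′≡0 : ∀ x → x ∈ Z ∪ ⁅ e ⁆ → c′ x ≡ 0#
      c′≡0 x _ with x ≟ e
      ... | yes refl = c′ₑ≡0
      ... | no  x≢e  = c′≡0-off-e x x≢e

module MatroidRank {n : ℕ} (M : Matroid n) where

  open import Data.Nat using (_+_)
  open import Data.Nat.Properties
  open Matroid M renaming (rank to r)
  open ≤-Reasoning

  private variable
    A B C D U I Z : Subset n
    e f : Fin n

  r⊥≡0 : r ⊥ ≡ 0
  r⊥≡0 = n≤0⇒n≡0 (≤-trans (bounded ⊥) (≤-reflexive (∣⊥∣≡0 n)))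

  submod-⊆ : U ⊆ A ∪ B → I ⊆ A ∩ B → r U + r I ≤ r A + r B
  submod-⊆ {A = A} {B = B} U⊆ I⊆ = ≤-trans (+-mono-≤ (mono _ _ U⊆) (mono _ _ I⊆)) (submod A B)

  r-∪-≤ : ∀ A B → r (A ∪ B) ≤ r A + r B
  r-∪-≤ A B = begin
    r (A ∪ B)       ≡⟨ +-identityʳ _ ⟨
    r (A ∪ B) + 0   ≡⟨ cong (r (A ∪ B) +_) r⊥≡0 ⟨
    r (A ∪ B) + r ⊥ ≤⟨ submod-⊆ id (λ x∈⊥ → contradiction x∈⊥ ∉⊥) ⟩
    r A + r B       ∎

  r-∪⁅⁆-cases : ∀ A e → r (A ∪ ⁅ e ⁆) ≡ r A ⊎ r (A ∪ ⁅ e ⁆) ≡ suc (r A)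
  r-∪⁅⁆-cases A e with m≤n⇒m<n∨m≡n (mono A (A ∪ ⁅ e ⁆) (p⊆p∪q ⁅ e ⁆))
  ... | inj₂ r≡ = inj₁ (sym r≡)
  ... | inj₁ r< = inj₂ (≤-antisym upper r<)
    where
    upper : r (A ∪ ⁅ e ⁆) ≤ suc (r A)
    upper = begin
      r (A ∪ ⁅ e ⁆)   ≤⟨ r-∪-≤ A ⁅ e ⁆ ⟩
      r A + r ⁅ e ⁆   ≤⟨ +-monoʳ-≤ (r A) (≤-trans (bounded ⁅ e ⁆) (≤-reflexive (∣⁅x⁆∣≡1 e))) ⟩
      r A + 1         ≡⟨ +-comm (r A) 1 ⟩
      suc (r A)       ∎

  r⁅⁆-cases : ∀ e → r ⁅ e ⁆ ≡ 0 ⊎ r ⁅ e ⁆ ≡ 1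
  r⁅⁆-cases e with r-∪⁅⁆-cases ⊥ e
  ... | inj₁ eq = inj₁ (trans (cong r (sym (∪-identityˡ ⁅ e ⁆))) (trans eq r⊥≡0))
  ... | inj₂ eq = inj₂ (trans (cong r (sym (∪-identityˡ ⁅ e ⁆))) (trans eq (cong suc r⊥≡0)))

  loop-spanned : r ⁅ e ⁆ ≡ 0 → ∀ A → r (A ∪ ⁅ e ⁆) ≤ r A
  loop-spanned {e = e} loop A = begin
    r (A ∪ ⁅ e ⁆)   ≤⟨ r-∪-≤ A ⁅ e ⁆ ⟩
    r A + r ⁅ e ⁆   ≡⟨ cong (r A +_) loop ⟩
    r A + 0         ≡⟨ +-identityʳ (r A) ⟩
    r A             ∎

  parallel-spanned : f ∈ A → r ⁅ f ⁆ ≡ 1 → r (⁅ e ⁆ ∪ ⁅ f ⁆) ≡ 1 → r (A ∪ ⁅ e ⁆) ≤ r A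
  parallel-spanned {f = f} {A = A} {e = e} f∈A nonloop parallel = +-cancelʳ-≤ 1 _ _ (begin
    r (A ∪ ⁅ e ⁆) + 1                ≡⟨ cong (r (A ∪ ⁅ e ⁆) +_) nonloop ⟨
    r (A ∪ ⁅ e ⁆) + r ⁅ f ⁆          ≤⟨ submod-⊆ (∪-mono id (p⊆p∪q ⁅ f ⁆))
                                                 (∩-glb (⁅x⁆⊆p f∈A) (q⊆p∪q ⁅ e ⁆ ⁅ f ⁆)) ⟩
    r A + r (⁅ e ⁆ ∪ ⁅ f ⁆)          ≡⟨ cong (r A +_) parallel ⟩
    r A + 1                          ∎)

  spanned⇒dependent : e ∈ Z → r ((Z - e) ∪ ⁅ e ⁆) ≤ r (Z - e) → r Z ≢ ∣ Z ∣
  spanned⇒dependent {e = e} {Z = Z} e∈Z spanned indep = <-irrefl refl (begin-strict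
    ∣ Z ∣                ≡⟨ indep ⟨
    r Z                  ≡⟨ cong r (p-x∪⁅x⁆≡p e∈Z) ⟨
    r ((Z - e) ∪ ⁅ e ⁆)  ≤⟨ spanned ⟩
    r (Z - e)            ≤⟨ bounded (Z - e) ⟩
    ∣ Z - e ∣            <⟨ x∈p⇒∣p-x∣<∣p∣ e∈Z ⟩
    ∣ Z ∣                ∎)

  r-exchange-parallel : e ∈ Z → f ∉ Z → r ⁅ e ⁆ ≡ 1 → r ⁅ f ⁆ ≡ 1 → r (⁅ e ⁆ ∪ ⁅ f ⁆) ≡ 1 →
                        r Z ≡ r ((Z - e) ∪ ⁅ f ⁆)
  r-exchange-parallel {e = e} {Z = Z} {f = f} e∈Z f∉Z e-nonloop f-nonloop parallel = ≤-antisym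
    (begin
      r Z                        ≤⟨ mono _ _ (⊆-trans (p⊆p-x∪⁅x⁆ Z e) (∪-mono (p⊆p∪q ⁅ f ⁆) id)) ⟩
      r (Z′ ∪ ⁅ e ⁆)             ≤⟨ parallel-spanned (q⊆p∪q (Z - e) ⁅ f ⁆ (x∈⁅x⁆ f))
                                                     f-nonloop parallel ⟩
      r Z′                       ∎)
    (begin
      r Z′                       ≤⟨ mono _ _ (∪-mono (p─q⊆p Z ⁅ e ⁆) id) ⟩
      r (Z ∪ ⁅ f ⁆)              ≤⟨ parallel-spanned e∈Z e-nonloop
                                       (trans (cong r (∪-comm ⁅ f ⁆ ⁅ e ⁆)) parallel) ⟩
      r Z                        ∎)
    where
    Z′ = (Z - e) ∪ ⁅ f ⁆

  r-∪-spanned : ∀ Z → r (C ∪ D) ≡ r C → r (Z ∪ (C ∪ D)) ≡ r (Z ∪ C)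
  r-∪-spanned {C = C} {D = D} Z spanned = ≤-antisym
    (+-cancelʳ-≤ (r C) _ _ (begin
      r (Z ∪ (C ∪ D)) + r C      ≤⟨ submod-⊆ (∪-mono (p⊆p∪q C) id)
                                             (∩-glb (q⊆p∪q Z C) (p⊆p∪q D)) ⟩
      r (Z ∪ C) + r (C ∪ D)      ≡⟨ cong (r (Z ∪ C) +_) spanned ⟩
      r (Z ∪ C) + r C            ∎))
    (mono _ _ (∪-mono id (p⊆p∪q D)))

  -- X and D are skew in M / C: the reverse inequality is an instance of submodularity.
  Skew : Subset n → Subset n → Subset n → Set
  Skew C X D = r (C ∪ X) + r (D ∪ C) ≤ r ((D ∪ C) ∪ X) + r C

  skew-⊆ : ∀ {X} → Z ⊆ D → Skew C X D → r ((Z ∪ C) ∪ X) + r C ≡ r (Z ∪ C) + r (C ∪ X)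
  skew-⊆ {Z = Z} {D = D} {C = C} {X} Z⊆D skew = ≤-antisym Z-submod (+-cancelʳ-≤ Q _ _ (begin
      p + u + Q     ≡⟨ +-assoc p u Q ⟩
      p + (u + Q)   ≤⟨ +-monoʳ-≤ p skew ⟩
      p + (P + c)   ≡⟨ x∙yz≈yx∙z p P c ⟩
      P + p + c     ≤⟨ +-monoˡ-≤ c D-submod ⟩
      s + Q + c     ≡⟨ xy∙z≈xz∙y s Q c ⟩
      s + c + Q     ∎))
    where
    open import Algebra.Properties.CommutativeSemigroup +-commutativeSemigroup
      using (x∙yz≈yx∙z; xy∙z≈xz∙y)
    s = r ((Z ∪ C) ∪ X)
    p = r (Z ∪ C)
    u = r (C ∪ X)
    c = r C
    P = r ((D ∪ C) ∪ X)
    Q = r (D ∪ C)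
    D-submod : P + p ≤ s + Q
    D-submod = submod-⊆ (∪-lub (q⊆p∪q _ (D ∪ C)) (p⊆p∪q (D ∪ C) ∘ q⊆p∪q (Z ∪ C) X))
                        (∩-glb (p⊆p∪q X) (∪-mono Z⊆D id))
    Z-submod : s + c ≤ p + u
    Z-submod = submod-⊆ (∪-mono id (q⊆p∪q C X)) (∩-glb (q⊆p∪q Z C) (p⊆p∪q X))

module Representations {q : ℕ} (F : FiniteField q) where

  open import Data.Nat using (_∸_)
  open import Data.Nat.Properties using (suc-injective; m+n∸n≡m)
  open FiniteField F using (0#; inverse)
  open LinearAlgebra F

  RepresentedBy : ∀ {n k} → Minor n → (Fin n → Fin k → Fin q) → Set
  RepresentedBy N v = ∀ Z → Z ⊆ ground N → Indep N Z ⇔ LinIndep F v Z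

  represented⇒representable : ∀ {n k} {N : Minor n} {v : Fin n → Fin k → Fin q} →
                              RepresentedBy N v → Representable F N
  represented⇒representable {v = v} v-rep =
    _ , v , λ Z Z⊆ → Equivalence.to (v-rep Z Z⊆) , Equivalence.from (v-rep Z Z⊆)

  RepresentedBy-⊆ : ∀ {n k} {N N′ : Minor n} {v : Fin n → Fin k → Fin q} →
                    ground N′ ⊆ ground N → (∀ Z → Z ⊆ ground N′ → rk N′ Z ≡ rk N Z) →
                    RepresentedBy N v → RepresentedBy N′ v
  RepresentedBy-⊆ {N = N} {N′} {v} ground⊆ same-rank v-rep Z Z⊆ = begin
    (rk N′ Z ≡ ∣ Z ∣) ≈⟨ cong-≡⇔ (same-rank Z Z⊆) refl ⟩
    (rk N Z ≡ ∣ Z ∣)  ≈⟨ v-rep Z (ground⊆ ∘ Z⊆) ⟩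
    LinIndep F v Z    ∎
    where open ⇔-Reasoning

  module _ {n k : ℕ} (M : Matroid n) where

    open Matroid M renaming (rank to r)
    open MatroidRank M

    private variable
      A C G R Z : Subset n
      e f : Fin n
      v w : Fin n → Fin k → Fin q

    indep⇔-updateAt-away : ∀ g → RepresentedBy (minor r A) w → Z ⊆ A ∪ ⁅ e ⁆ → e ∉ Z →
                           (r Z ≡ ∣ Z ∣) ⇔ LinIndep F (updateAt w e g) Z
    indep⇔-updateAt-away {w = w} {Z = Z} {e = e} g w-rep Z⊆ e∉Z = begin
      (r Z ≡ ∣ Z ∣)                ≈⟨ w-rep Z (p⊆q∪⁅x⁆∧x∉p⇒p⊆q Z⊆ e∉Z) ⟩
      LinIndep F w Z               ≈⟨ mk⇔ (LinIndep-cong same)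
                                          (LinIndep-cong (λ x x∈Z t → sym (same x x∈Z t))) ⟩
      LinIndep F (updateAt w e g) Z ∎
      where
      open ⇔-Reasoning
      same : ∀ x → x ∈ Z → ∀ t → w x t ≡ updateAt w e g x t
      same x x∈Z t = cong (λ u → u t) (sym (updateAt-minimal x e w (λ { refl → e∉Z x∈Z })))

    loop-extension : r ⁅ e ⁆ ≡ 0 → RepresentedBy (minor r A) w →
                     RepresentedBy (minor r (A ∪ ⁅ e ⁆)) (updateAt w e (const (const 0#)))
    loop-extension {e = e} {w = w} loop w-rep Z Z⊆ with e ∈? Z
    ... | no  e∉Z = indep⇔-updateAt-away _ w-rep Z⊆ e∉Z
    ... | yes e∈Z = ¬×¬⇒⇔ (spanned⇒dependent e∈Z (loop-spanned loop (Z - e)))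
                          (¬LinIndep-zero e∈Z (λ t → cong (λ u → u t) (updateAt-updates e w)))

    parallel-extension : e ∉ A → f ∈ A → r ⁅ e ⁆ ≡ 1 → r ⁅ f ⁆ ≡ 1 → r (⁅ e ⁆ ∪ ⁅ f ⁆) ≡ 1 →
                         RepresentedBy (minor r A) w →
                         RepresentedBy (minor r (A ∪ ⁅ e ⁆)) (updateAt w e (const (w f)))
    parallel-extension {e = e} {A = A} {f = f} {w = w}
                       e∉A f∈A e-nonloop f-nonloop parallel w-rep Z Z⊆ = by-cases (e ∈? Z) (f ∈? Z)
      where
      w′ : Fin n → Fin k → Fin q
      w′ = updateAt w e (const (w f))
      f≢e : f ≢ e
      f≢e refl = e∉A f∈A
      w′ₑ≡w′_f : ∀ t → w′ e t ≡ w′ f t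
      w′ₑ≡w′_f t =
        cong (λ u → u t) (trans (updateAt-updates e w) (sym (updateAt-minimal f e w f≢e)))
      exchange : e ∈ Z → f ∉ Z → (r Z ≡ ∣ Z ∣) ⇔ LinIndep F w′ Z
      exchange e∈Z f∉Z = begin
        (r Z ≡ ∣ Z ∣)       ≈⟨ cong-≡⇔ (r-exchange-parallel e∈Z f∉Z e-nonloop f-nonloop parallel)
                                       same-size ⟩
        (r Z′ ≡ ∣ Z′ ∣)     ≈⟨ indep⇔-updateAt-away _ w-rep Z′⊆ e∉Z′ ⟩
        LinIndep F w′ Z′    ≈⟨ mk⇔ (LinIndep-exchange w′ₑ≡w′_f f∉Z) backwards ⟩
        LinIndep F w′ Z     ∎
        where
        open ⇔-Reasoning
        Z′ = (Z - e) ∪ ⁅ f ⁆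
        same-size : ∣ Z ∣ ≡ ∣ Z′ ∣
        same-size = trans (∣p∣≡1+∣p-x∣ e∈Z) (sym (∣p∪⁅x⁆∣≡1+∣p∣ (f∉Z ∘ p─q⊆p Z ⁅ e ⁆)))
        Z′⊆ : Z′ ⊆ A ∪ ⁅ e ⁆
        Z′⊆ = ∪-lub (Z⊆ ∘ p─q⊆p Z ⁅ e ⁆) (p⊆p∪q ⁅ e ⁆ ∘ ⁅x⁆⊆p f∈A)
        e∉Z′ : e ∉ Z′
        e∉Z′ = x∉p∧x≢y⇒x∉p∪⁅y⁆ (x∉p-x Z e) (f≢e ∘ sym)
        backwards : LinIndep F w′ Z → LinIndep F w′ Z′
        backwards = LinIndep-exchange (sym ∘ w′ₑ≡w′_f) e∉Z′
                  ∘ LinIndep-mono (∪-lub (p─q⊆p Z ⁅ e ⁆ ∘ p∪q─q⊆p (Z - e) ⁅ f ⁆) (⁅x⁆⊆p e∈Z))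
      by-cases : Dec (e ∈ Z) → Dec (f ∈ Z) → (r Z ≡ ∣ Z ∣) ⇔ LinIndep F w′ Z
      by-cases (no  e∉Z) _         = indep⇔-updateAt-away _ w-rep Z⊆ e∉Z
      by-cases (yes e∈Z) (no  f∉Z) = exchange e∈Z f∉Z
      by-cases (yes e∈Z) (yes f∈Z) =
        ¬×¬⇒⇔ (spanned⇒dependent e∈Z
                 (parallel-spanned (x∈p∧x≢y⇒x∈p-y f∈Z f≢e) f-nonloop parallel))
              (¬LinIndep-repeat e∈Z f∈Z (f≢e ∘ sym) w′ₑ≡w′_f)

    simplification-representable : IsSimplificationSet (minor r G) R → RepresentedBy (minor r R) v →
                                   Σ (Fin n → Fin k → Fin q) (RepresentedBy (minor r G))
    simplification-representable {G = G} {R = R} {v = v} (R⊆G , R-nonloops , parallel-in-R) v-rep =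
      map₂ (RepresentedBy-⊆ (q⊆p∪q R G) (λ _ _ → refl)) (subset-induction P base step G id)
      where
      P : Subset n → Set
      P D = D ⊆ G → Σ (Fin n → Fin k → Fin q) (RepresentedBy (minor r (R ∪ D)))
      base : P ⊥
      base _ = v , RepresentedBy-⊆ (∪-lub id (λ x∈⊥ → contradiction x∈⊥ ∉⊥)) (λ _ _ → refl) v-rep
      extend : ∀ {A} e → e ∈ G → R ⊆ A → Σ _ (RepresentedBy (minor r A)) →
               Σ _ (RepresentedBy (minor r (A ∪ ⁅ e ⁆)))
      extend {A} e e∈G R⊆A (w , w-rep) with e ∈? A | r⁅⁆-cases e
      ... | yes e∈A | _            = w , RepresentedBy-⊆ (∪-lub id (⁅x⁆⊆p e∈A)) (λ _ _ → refl) w-rep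
      ... | no  e∉A | inj₁ loop    = _ , loop-extension loop w-rep
      ... | no  e∉A | inj₂ nonloop =
        let ((f , f∈R , parallel) , _) = parallel-in-R e e∈G nonloop
        in  _ , parallel-extension e∉A (R⊆A f∈R) nonloop (R-nonloops f f∈R) parallel w-rep
      step : ∀ D e → e ∉ D → P D → P (D ∪ ⁅ e ⁆)
      step D e _ P-D D∪e⊆G =
        map₂ (RepresentedBy-⊆ (⊆-reflexive (sym (∪-assoc R D ⁅ e ⁆))) (λ _ _ → refl))
             (extend e (D∪e⊆G (q⊆p∪q D ⁅ e ⁆ (x∈⁅x⁆ e))) (p⊆p∪q D)
                     (P-D (D∪e⊆G ∘ p⊆p∪q ⁅ e ⁆)))

    contraction-step : e ∈ G ─ C → r (C ∪ ⁅ e ⁆) ≡ suc (r C) →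
                       RepresentedBy (contract (minor r G) C) w →
                       Σ (Fin n → Fin k → Fin q) (RepresentedBy (contract (minor r G) (C ∪ ⁅ e ⁆)))
    contraction-step {e = e} {G = G} {C = C} {w = w} e∈G─C r-grows w-rep = project , project-rep
      where
      e-indep : LinIndep F w ⁅ e ⁆
      e-indep = Equivalence.to (w-rep ⁅ e ⁆ (⁅x⁆⊆p e∈G─C)) (begin
        r (⁅ e ⁆ ∪ C) ∸ r C ≡⟨ cong (λ S → r S ∸ r C) (∪-comm ⁅ e ⁆ C) ⟩
        r (C ∪ ⁅ e ⁆) ∸ r C ≡⟨ cong (_∸ r C) r-grows ⟩
        suc (r C) ∸ r C     ≡⟨ m+n∸n≡m 1 (r C) ⟩
        1                   ≡⟨ ∣⁅x⁆∣≡1 e ⟨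
        ∣ ⁅ e ⁆ ∣           ∎)
        where open ≡-Reasoning
      nonzero-coordinate : Σ (Fin k) (λ j → w e j ≢ 0#)
      nonzero-coordinate =
        Fin.¬∀⟶∃¬ k _ (λ j → w e j ≟ 0#) (λ wₑ≡0 → ¬LinIndep-zero (x∈⁅x⁆ e) wₑ≡0 e-indep)
      j = proj₁ nonzero-coordinate
      ι = proj₁ (inverse (w e j) (proj₂ nonzero-coordinate))
      open Projection w e j ι (proj₂ (inverse (w e j) (proj₂ nonzero-coordinate)))
      project-rep : RepresentedBy (contract (minor r G) (C ∪ ⁅ e ⁆)) project
      project-rep Z Z⊆ = begin
        (a ∸ r (C ∪ ⁅ e ⁆) ≡ ∣ Z ∣)                  ≈⟨ cong-≡⇔ (cong (a ∸_) r-grows) refl ⟩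
        (a ∸ suc (r C) ≡ ∣ Z ∣)                      ≈⟨ m∸1+n≡o⇔m∸n≡1+o a-large ⟩
        (a ∸ r C ≡ suc ∣ Z ∣)                        ≈⟨ cong-≡⇔ (cong (λ S → r S ∸ r C) same-set)
                                                              (sym (∣p∪⁅x⁆∣≡1+∣p∣ e∉Z)) ⟩
        (r ((Z ∪ ⁅ e ⁆) ∪ C) ∸ r C ≡ ∣ Z ∪ ⁅ e ⁆ ∣)  ≈⟨ w-rep (Z ∪ ⁅ e ⁆) Z∪e⊆ ⟩
        LinIndep F w (Z ∪ ⁅ e ⁆)                     ≈⟨ mk⇔ (LinIndep-project⁺ e∉Z)
                                                              LinIndep-project⁻ ⟩
        LinIndep F project Z                         ∎
        where
        open ⇔-Reasoning
        a = r (Z ∪ (C ∪ ⁅ e ⁆))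
        a-large : suc (r C) ≤ a
        a-large = subst (_≤ a) r-grows (mono _ _ (q⊆p∪q Z (C ∪ ⁅ e ⁆)))
        same-set : Z ∪ (C ∪ ⁅ e ⁆) ≡ (Z ∪ ⁅ e ⁆) ∪ C
        same-set = trans (cong (Z ∪_) (∪-comm C ⁅ e ⁆)) (sym (∪-assoc Z ⁅ e ⁆ C))
        e∉Z : e ∉ Z
        e∉Z e∈Z = x∈p─q⇒x∉q G (C ∪ ⁅ e ⁆) (Z⊆ e∈Z) (q⊆p∪q C ⁅ e ⁆ (x∈⁅x⁆ e))
        Z∪e⊆ : Z ∪ ⁅ e ⁆ ⊆ G ─ C
        Z∪e⊆ = ∪-lub (p─q∪r⊆p─q G C ⁅ e ⁆ ∘ Z⊆) (⁅x⁆⊆p e∈G─C)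

    contraction-representable : RepresentedBy (minor r G) w → ∀ C → C ⊆ G →
                                Σ (Fin n → Fin k → Fin q) (RepresentedBy (contract (minor r G) C))
    contraction-representable {G = G} {w = w} w-rep = subset-induction Q base step
      where
      Q : Subset n → Set
      Q C = C ⊆ G → Σ (Fin n → Fin k → Fin q) (RepresentedBy (contract (minor r G) C))
      base : Q ⊥
      base _ = w , RepresentedBy-⊆ (p─q⊆p G ⊥) (λ Z _ → cong₂ _∸_ (cong r (∪-identityʳ Z)) r⊥≡0)
                                   w-rep
      step : ∀ C e → e ∉ C → Q C → Q (C ∪ ⁅ e ⁆)
      step C e e∉C Q-C C∪e⊆G with Q-C (C∪e⊆G ∘ p⊆p∪q ⁅ e ⁆) | r-∪⁅⁆-cases C e
      ... | w′ , w′-rep | inj₁ e-spanned =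
        w′ , RepresentedBy-⊆ (p─q∪r⊆p─q G C ⁅ e ⁆)
                             (λ Z _ → cong₂ _∸_ (r-∪-spanned Z e-spanned) e-spanned) w′-rep
      ... | w′ , w′-rep | inj₂ r-grows =
        contraction-step (x∈p∧x∉q⇒x∈p─q (C∪e⊆G (q⊆p∪q C ⁅ e ⁆ (x∈⁅x⁆ e))) e∉C) r-grows w′-rep

∉-before : ∀ {q n m} (F : FiniteField q) (Ds : Fin m → Subset n) →
           (∀ i j → i ≢ j → Ds i ∩ Ds j ≡ ⊥) → ∀ i {x} → x ∈ Ds i → x ∉ before F Ds i
∉-before F Ds disjoint zero    _     = ∉⊥
∉-before F Ds disjoint (suc i) x∈Dsᵢ x∈before with x∈p∪q⁻ (Ds zero) _ x∈before
... | inj₁ x∈Ds₀ = ∉⊥ (subst (_ ∈_) (disjoint (suc i) zero (λ ())) (x∈p∩q⁺ (x∈Dsᵢ , x∈Ds₀)))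
... | inj₂ x∈later = ∉-before F (Ds ∘ suc) disjoint′ i x∈Dsᵢ x∈later
  where
  disjoint′ : ∀ i j → i ≢ j → Ds (suc i) ∩ Ds (suc j) ≡ ⊥
  disjoint′ i j i≢j = disjoint (suc i) (suc j) (i≢j ∘ Fin.suc-injective)

module Stacks {q : ℕ} (F : FiniteField q) {n : ℕ} (M : Matroid n) (X : Subset n) where

  open import Data.Nat using (_+_; _∸_; s≤s)
  open import Data.Nat.Properties
  open import Algebra.Properties.CommutativeSemigroup +-commutativeSemigroup using (xy∙z≈xz∙y)

  open Matroid M renaming (rank to r)
  open MatroidRank M
  open Representations F

  G : Subset n
  G = ⊤ ─ X

  -- (M / X / C) | D: the layer F_i of a stack in M / X when C = F₁ ∪ … ∪ F_{i-1}.
  Layer : Subset n → Subset n → Minor n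
  Layer C D = restrict (contract (contract (asMinor M) X) C) D

  NonrepresentableLayer : Subset n → Subset n → Set
  NonrepresentableLayer C D = (D ⊆ G ─ C) × ¬ Representable F (Layer C D)

  module _ {k} {w : Fin n → Fin k → Fin q} (w-rep : RepresentedBy (delete (asMinor M) X) w) where

    skew⇒representable : ∀ {C D} → C ⊆ G → D ⊆ G ─ C → Skew C X D → Representable F (Layer C D)
    skew⇒representable {C} {D} C⊆G D⊆ skew with contraction-representable M w-rep C C⊆G
    ... | w′ , w′-rep = represented⇒representable (RepresentedBy-⊆ D⊆ layer-rank w′-rep)
      where
      layer-rank : ∀ Z → Z ⊆ D → (r ((Z ∪ C) ∪ X) ∸ r X) ∸ (r (C ∪ X) ∸ r X) ≡ r (Z ∪ C) ∸ r C
      layer-rank Z Z⊆D = trans ([m∸n]∸[o∸n]≡m∸o _ (mono X (C ∪ X) (q⊆p∪q C X)))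
                               (m+n≡o+p⇒m∸p≡o∸n _ (r C) (r (Z ∪ C)) (r (C ∪ X)) (skew-⊆ Z⊆D skew))

    layers-bound : ∀ m C (Ds : Fin m → Subset n) → C ⊆ G →
                   (∀ i → NonrepresentableLayer (C ∪ before F Ds i) (Ds i)) → m + r C ≤ r (C ∪ X)
    layers-bound zero    C Ds C⊆G layers = mono C (C ∪ X) (p⊆p∪q X)
    layers-bound (suc m) C Ds C⊆G layers = +-cancelʳ-≤ (r (D ∪ C)) _ _ (begin
      suc m + r C + r (D ∪ C)             ≡⟨ cong suc (xy∙z≈xz∙y m (r C) (r (D ∪ C))) ⟩
      suc (m + r (D ∪ C) + r C)           ≤⟨ s≤s (+-monoˡ-≤ (r C) later-layers) ⟩
      suc (r ((D ∪ C) ∪ X) + r C)         ≤⟨ ≰⇒> (nonrep ∘ skew⇒representable C⊆G D⊆G─C) ⟩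
      r (C ∪ X) + r (D ∪ C)               ∎)
      where
      open ≤-Reasoning
      D = Ds zero
      first-layer : NonrepresentableLayer C D
      first-layer = subst (λ S → NonrepresentableLayer S D) (∪-identityʳ C) (layers zero)
      D⊆G─C = proj₁ first-layer
      nonrep = proj₂ first-layer
      shift : ∀ i → C ∪ before F Ds (suc i) ≡ (D ∪ C) ∪ before F (Ds ∘ suc) i
      shift i = trans (sym (∪-assoc C D _)) (cong (_∪ before F (Ds ∘ suc) i) (∪-comm C D))
      later-layers : m + r (D ∪ C) ≤ r ((D ∪ C) ∪ X)
      later-layers = layers-bound m (D ∪ C) (Ds ∘ suc) (∪-lub (p─q⊆p G C ∘ D⊆G─C) C⊆G)
        (λ i → subst (λ S → NonrepresentableLayer S (Ds (suc i))) (shift i) (layers (suc i)))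

    stack-height≤rank : ∀ {m} Y → Y ⊆ G →
                        IsStack F m (restrict (contract (asMinor M) X) Y) → m ≤ r X
    stack-height≤rank {m} Y Y⊆G (_ , Fs , Fs⊆Y , disjoint , _ , layers) = begin
      m             ≤⟨ m≤m+n m (r ⊥) ⟩
      m + r ⊥       ≤⟨ layers-bound m ⊥ Fs (λ x∈⊥ → contradiction x∈⊥ ∉⊥) nonrepresentable ⟩
      r (⊥ ∪ X)     ≡⟨ cong r (∪-identityˡ X) ⟩
      r X           ∎
      where
      open ≤-Reasoning
      nonrepresentable : ∀ i → NonrepresentableLayer (⊥ ∪ before F Fs i) (Fs i)
      nonrepresentable i = subst (λ S → NonrepresentableLayer S (Fs i)) (sym (∪-identityˡ _))
        ( (λ x∈Fsᵢ → x∈p∧x∉q⇒x∈p─q (Y⊆G (Fs⊆Y i x∈Fsᵢ)) (∉-before F Fs disjoint i x∈Fsᵢ))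
        , proj₂ (layers i))

lemma4p1 : ∀ {q : ℕ} → IsPrimePower q → (F : FiniteField q) → (h : ℕ) →
    ∀ {n : ℕ} (M : Matroid n) (X : Subset n) →
    Matroid.rank M X ≤ h →
    SiIsoPG F (delete (asMinor M) X) (Matroid.rank M ⊤) →
    ∀ (Y : Subset n) → Y ⊆ ground (contract (asMinor M) X) →
    ¬ IsStack F (suc h) (restrict (contract (asMinor M) X) Y)
lemma4p1 _ F h M X rX≤h (_ , simplification , (_ , _ , _ , _ , φ-rep)) Y Y⊆ stack =
  ≤⇒≯ rX≤h (stack-height≤rank w-rep Y Y⊆ stack)
  where
  open Representations F
  open Stacks F M X
  w-rep = proj₂ (simplification-representable M simplification
                   (λ Z Z⊆ → mk⇔ (proj₁ (φ-rep Z Z⊆)) (proj₂ (φ-rep Z Z⊆))))
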